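{- Let $\mu\ge 3$ and $n=2\mu$. Then $(P_2\times K_\mu)(s_1,\dots,s_n)\in\mathscr{C}_1$ for all integers $s_1,\dots,s_n\ge 2$.
   Context: $P_2$ is the path on 2 vertices and $K_\mu$ the complete graph on $\mu$ vertices. The cartesian product $G\times H$ has vertex set $V(G)\times V(H)$, with $\langle u,x\rangle\langle v,y\rangle$ an edge iff either $u=v$ and $xy\in E(H)$, or $uv\in E(G)$ and $x=y$. For a graph $G$ with vertex set $\{v_1,\dots,v_n\}$ and positive integers $s_1,\dots,s_n$, the vertex-multiplication $G(s_1,\dots,s_n)$ is the graph whose vertex set is a disjoint union $V_1\cup\dots\cup V_n$ with $|V_i|=s_i$, where $u\in V_i$ and $v\in V_j$ are adjacent iff $i\ne j$ and $v_iv_j\in E(G)$. For a connected bridgeless graph $X$, $\bar d(X)$ is the minimum diameter of a strong orientation of $X$. $\mathscr{C}_1$ is the class of vertex-multiplications $G(s_1,\dots,s_n)$ of a connected graph $G$ with all $s_i\ge 2$ such that $\bar d(G(s_1,\dots,s_n))=d(G)+1$, $d(G)$ the diameter of $G$. -}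

module Defs where

open import Data.Nat using (ℕ; zero; suc; _≤_; _<_)
open import Data.Fin using (Fin)
open import Data.Product using (Σ; ∃; _×_; _,_)
open import Data.Sum using (_⊎_)
open import Relation.Nullary using (¬_)
open import Relation.Binary.PropositionalEquality using (_≡_)

-- A (simple, undirected) graph: vertex type and an adjacency relation.
-- The concrete graphs used below are symmetric and irreflexive.
record Graph : Set₁ where
  field
    V : Set
    E : V → V → Set
open Graph public

data Walk {V : Set} (R : V → V → Set) : ℕ → V → V → Set where
  []  : ∀ {u} → Walk R 0 u u
  _∷_ : ∀ {u v w n} → R u v → Walk R n v w → Walk R (suc n) u w

DistLe : {V : Set} → (V → V → Set) → ℕ → V → V → Set
DistLe R k u v = Σ ℕ λ m → m ≤ k × Walk R m u v

DistGe : {V : Set} → (V → V → Set) → ℕ → V → V → Set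
DistGe R k u v = ∀ m → m < k → ¬ Walk R m u v

IsDiam : {V : Set} → (V → V → Set) → ℕ → Set
IsDiam {V} R d = (∀ u v → DistLe R d u v) × (Σ V λ u → Σ V λ v → DistGe R d u v)

Connected : Graph → Set
Connected G = ∀ u v → Σ ℕ λ m → Walk (E G) m u v

IsOrientation : (G : Graph) → (V G → V G → Set) → Set
IsOrientation G D =
  (∀ u v → D u v → E G u v) ×
  (∀ u v → E G u v → D u v ⊎ D v u) ×
  (∀ u v → D u v → ¬ D v u)

Strong : {V : Set} → (V → V → Set) → Set
Strong R = ∀ u v → Σ ℕ λ m → Walk R m u v

MinOrientedDiam : Graph → ℕ → Set₁
MinOrientedDiam G k =
  (Σ (V G → V G → Set) λ D → IsOrientation G D × Strong D × IsDiam D k) ×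
  (∀ (D : V G → V G → Set) → IsOrientation G D → Strong D →
     ∀ d → IsDiam D d → k ≤ d)

P₂ : Graph
P₂ = record { V = Fin 2 ; E = λ x y → ¬ x ≡ y }

K : ℕ → Graph
K μ = record { V = Fin μ ; E = λ x y → ¬ x ≡ y }

_□_ : Graph → Graph → Graph
G □ H = record
  { V = V G × V H
  ; E = λ { (u , x) (v , y) → (u ≡ v × E H x y) ⊎ (E G u v × x ≡ y) } }

VMult : (G : Graph) → (V G → ℕ) → Graph
VMult G s = record
  { V = Σ (V G) (λ i → Fin (s i))
  ; E = λ { (i , _) (j , _) → ¬ i ≡ j × E G i j } }

InC₁ : (G : Graph) → (V G → ℕ) → Set₁
InC₁ G s =
  Connected G × (∀ i → 2 ≤ s i) ×
  (Σ ℕ λ d → IsDiam (E G) d × MinOrientedDiam (VMult G s) (suc d))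

-- Split every part V_p of H(s), H = P₂ □ K_μ, into vertices of two types, and direct the edge
-- between (p, k) and (q, l) from (p, k) to (q, l) iff the types differ by σ p q, for an
-- antisymmetric labelling σ of the edges of H.  A walk of length ≥ 1 in H then lifts to a directed
-- walk between any two vertices whose types differ by the σ-parity of the walk.  So all oriented
-- distances are at most 3 once any two vertices of H are joined by walks of length ≤ 3 of both
-- parities: along an edge p q by p q and p q p q; across a 4-cycle because σ makes every 4-cycle
-- odd; and from a vertex to itself around a triangle in its two directions, which needs μ ≥ 3.
-- Conversely the ends of a rung (a, i) (b, i) have no common neighbour, so in every orientation
-- the head of the rung is at distance at least 3 from its tail.

module Submission where

open import Defs
open import Data.Bool using (Bool; true; false; not; _xor_; _≟_)
open import Data.Bool.Properties
  using (¬-not; not-¬; not-involutive; xor-assoc; xor-same; xor-inverseʳ)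
open import Data.Empty using (⊥)
open import Data.Fin using (Fin; zero; suc; toℕ) renaming (_≟_ to _≟ᶠ_)
open import Data.Fin.Properties using (toℕ-injective)
open import Data.Nat using (ℕ; zero; suc; _≤_; _<ᵇ_; z≤n; s≤s)
open import Data.Nat.Properties using (≤-trans; ≮⇒≥; n≤1+n)
open import Data.Product using (Σ; _×_; _,_; proj₁; proj₂)
open import Data.Sum using (_⊎_; inj₁; inj₂)
open import Function using (_∘_)
open import Relation.Nullary using (¬_; yes; no; contradiction)
open import Relation.Binary.PropositionalEquality
  using (_≡_; _≢_; refl; sym; trans; cong; ≢-sym; module ≡-Reasoning)

xor-cancelˡ : ∀ x y → x xor (x xor y) ≡ y
xor-cancelˡ false y = refl
xor-cancelˡ true  y = not-involutive y

xor-xor-not : ∀ x c → (x xor c) xor not c ≡ not x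
xor-xor-not false c = xor-inverseʳ c
xor-xor-not true  c = xor-same (not c)

not-xor-xor-not : ∀ x c → not (x xor c) xor not c ≡ x
not-xor-xor-not false c = xor-same (not c)
not-xor-xor-not true  c = trans (cong (_xor not c) (not-involutive c)) (xor-inverseʳ c)

<ᵇ-flip : ∀ {m n} → m ≢ n → (n <ᵇ m) ≡ not (m <ᵇ n)
<ᵇ-flip {zero}  {zero}  m≢n = contradiction refl m≢n
<ᵇ-flip {zero}  {suc n} _   = refl
<ᵇ-flip {suc m} {zero}  _   = refl
<ᵇ-flip {suc m} {suc n} m≢n = <ᵇ-flip (m≢n ∘ cong suc)

pigeonhole-Fin2 : {a b c : Fin 2} → a ≢ b → a ≢ c → c ≢ b → ⊥
pigeonhole-Fin2 {zero}     {zero}               a≢b _   _   = a≢b refl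
pigeonhole-Fin2 {zero}     {suc zero} {zero}     _   a≢c _   = a≢c refl
pigeonhole-Fin2 {zero}     {suc zero} {suc zero} _   _   c≢b = c≢b refl
pigeonhole-Fin2 {suc zero} {zero}     {zero}     _   _   c≢b = c≢b refl
pigeonhole-Fin2 {suc zero} {zero}     {suc zero} _   a≢c _   = a≢c refl
pigeonhole-Fin2 {suc zero} {suc zero}            a≢b _   _   = a≢b refl

DistGe-DistLe⇒≤ : ∀ {V : Set} {R : V → V → Set} {k d u v} →
                  DistGe R k u v → DistLe R d u v → k ≤ d
DistGe-DistLe⇒≤ far (m , m≤d , w) = ≤-trans (≮⇒≥ λ m<k → far m m<k w) m≤d

DistLe-all⇒Strong : ∀ {V : Set} {R : V → V → Set} {d} → (∀ u v → DistLe R d u v) → Strong R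
DistLe-all⇒Strong bounded u v = let (m , _ , w) = bounded u v in m , w

NoCommonNeighbour : (G : Graph) → V G → V G → Set
NoCommonNeighbour G u v = ∀ w → E G u w → E G w v → ⊥

VMult-noCommonNeighbour : ∀ H s {p q} → NoCommonNeighbour H p q →
                          ∀ k l → NoCommonNeighbour (VMult H s) (p , k) (q , l)
VMult-noCommonNeighbour H s none _ _ (r , _) (_ , pr) (_ , rq) = none r pr rq

module _ (G : Graph) {D : V G → V G → Set} (orientation : IsOrientation G D) where

  reverseArc⇒DistGe3 : ∀ {u v} → D v u → NoCommonNeighbour G u v → DistGe D 3 u v
  reverseArc⇒DistGe3 vu _ 0 _ [] = proj₂ (proj₂ orientation) _ _ vu vu
  reverseArc⇒DistGe3 vu _ 1 _ (uv ∷ []) = proj₂ (proj₂ orientation) _ _ uv vu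
  reverseArc⇒DistGe3 _ none 2 _ (uw ∷ (wv ∷ [])) =
    none _ (proj₁ orientation _ _ uw) (proj₁ orientation _ _ wv)
  reverseArc⇒DistGe3 _ _ (suc (suc (suc _))) (s≤s (s≤s (s≤s ()))) _

  farPair : ∀ {u v} → E G u v → NoCommonNeighbour G u v → NoCommonNeighbour G v u →
            Σ (V G) λ x → Σ (V G) λ y → DistGe D 3 x y
  farPair {u} {v} uv noUV noVU with proj₁ (proj₂ orientation) u v uv
  ... | inj₁ u→v = v , u , reverseArc⇒DistGe3 u→v noVU
  ... | inj₂ v→u = u , v , reverseArc⇒DistGe3 v→u noUV

  orientedDiam≥3 : ∀ {u v d} → E G u v → NoCommonNeighbour G u v → NoCommonNeighbour G v u →
                   IsDiam D d → 3 ≤ d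
  orientedDiam≥3 uv noUV noVU (bounded , _) =
    let (x , y , far) = farPair uv noUV noVU in DistGe-DistLe⇒≤ far (bounded x y)

type : ∀ {n} → Fin n → Bool
type zero    = false
type (suc _) = true

ofType : ∀ {n} → Bool → 2 ≤ n → Fin n
ofType false (s≤s _)       = zero
ofType true  (s≤s (s≤s _)) = suc zero

type-ofType : ∀ {n} t (2≤n : 2 ≤ n) → type (ofType t 2≤n) ≡ t
type-ofType false (s≤s _)       = refl
type-ofType true  (s≤s (s≤s _)) = refl

module Switching (H : Graph) (E-sym : ∀ {p q} → E H p q → E H q p)
                 (σ : V H → V H → Bool) (σ-antisym : ∀ {p q} → E H p q → σ q p ≡ not (σ p q)) where

  parity : ∀ {n p q} → Walk (E H) (suc n) p q → Bool
  parity (_∷_ {u = p} {v = r} _ [])          = σ p r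
  parity (_∷_ {u = p} {v = r} _ w@(_ ∷ _)) = σ p r xor parity w

  ShortWalk : Bool → V H → V H → Set
  ShortWalk β p q = Σ ℕ λ n → n ≤ 2 × Σ (Walk (E H) (suc n) p q) λ w → parity w ≡ β

  shortWalk-either : ∀ {m n p q} (w₁ : Walk (E H) (suc m) p q) (w₂ : Walk (E H) (suc n) p q) →
                     m ≤ 2 → n ≤ 2 → parity w₁ ≡ not (parity w₂) → ∀ β → ShortWalk β p q
  shortWalk-either {m} {n} w₁ w₂ m≤2 n≤2 opposite β with parity w₂ ≟ β
  ... | yes w₂-β = n , n≤2 , w₂ , w₂-β
  ... | no ¬w₂-β = m , m≤2 , w₁ , trans opposite (sym (¬-not (≢-sym ¬w₂-β)))

  edge-shortWalk : ∀ {p q} → E H p q → ∀ β → ShortWalk β p q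
  edge-shortWalk {p} {q} pq =
    shortWalk-either (pq ∷ []) (pq ∷ (E-sym pq ∷ (pq ∷ []))) z≤n (s≤s (s≤s z≤n)) bounce
    where
    flips : ∀ x → x ≡ not (x xor (not x xor x))
    flips false = refl
    flips true  = refl

    bounce : σ p q ≡ not (σ p q xor (σ q p xor σ p q))
    bounce rewrite σ-antisym pq = flips (σ p q)

  triangle-shortWalk : ∀ {p q r} → E H p q → E H q r → E H r p → ∀ β → ShortWalk β p p
  triangle-shortWalk {p} {q} {r} pq qr rp =
    shortWalk-either (pq ∷ (qr ∷ (rp ∷ []))) (E-sym rp ∷ (E-sym qr ∷ (E-sym pq ∷ [])))
                     (s≤s (s≤s z≤n)) (s≤s (s≤s z≤n)) reversal
    where
    flips : ∀ x y z → x xor (y xor z) ≡ not (not z xor (not y xor not x))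
    flips false false false = refl
    flips false false true  = refl
    flips false true  false = refl
    flips false true  true  = refl
    flips true  false false = refl
    flips true  false true  = refl
    flips true  true  false = refl
    flips true  true  true  = refl

    reversal : σ p q xor (σ q r xor σ r p) ≡ not (σ p r xor (σ r q xor σ q p))
    reversal rewrite σ-antisym pq | σ-antisym qr | σ-antisym rp = flips (σ p q) (σ q r) (σ r p)

  module _ (s : V H → ℕ) (2≤s : ∀ p → 2 ≤ s p) (loopless : ∀ {p q} → E H p q → p ≢ q) where

    Arc : V (VMult H s) → V (VMult H s) → Set
    Arc u@(p , k) v@(q , l) = E (VMult H s) u v × type l ≡ type k xor σ p q

    Arc-isOrientation : IsOrientation (VMult H s) Arc
    Arc-isOrientation = (λ _ _ → proj₁) , total , antisym
      where
      total : ∀ u v → E (VMult H s) u v → Arc u v ⊎ Arc v u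
      total (p , k) (q , l) uv@(p≢q , pq) with type l ≟ type k xor σ p q
      ... | yes forward = inj₁ (uv , forward)
      ... | no ¬forward = inj₂ ((≢-sym p≢q , E-sym pq) , backward)
        where
        backward : type k ≡ type l xor σ q p
        backward rewrite σ-antisym pq | ¬-not ¬forward = sym (not-xor-xor-not (type k) (σ p q))

      antisym : ∀ u v → Arc u v → ¬ Arc v u
      antisym (p , k) (q , l) ((_ , pq) , forward) (_ , backward) =
        not-¬ refl (trans backward' (xor-xor-not (type k) (σ p q)))
        where
        backward' : type k ≡ (type k xor σ p q) xor not (σ p q)
        backward' rewrite sym forward | sym (σ-antisym pq) = backward

    lift : ∀ {n p q} (w : Walk (E H) (suc n) p q) (k : Fin (s p)) (l : Fin (s q)) →
           type l ≡ type k xor parity w → Walk Arc (suc n) (p , k) (q , l)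
    lift (pq ∷ []) k l shift = ((loopless pq , pq) , shift) ∷ []
    lift {p = p} (_∷_ {v = r} pr w@(_ ∷ _)) k l shift =
      ((loopless pr , pr) , type-ofType _ (2≤s r)) ∷ lift w m l shift'
      where
      m : Fin (s r)
      m = ofType (type k xor σ p r) (2≤s r)

      open ≡-Reasoning
      shift' : type l ≡ type m xor parity w
      shift' = begin
        type l                            ≡⟨ shift ⟩
        type k xor (σ p r xor parity w)   ≡⟨ sym (xor-assoc (type k) (σ p r) (parity w)) ⟩
        (type k xor σ p r) xor parity w   ≡⟨ cong (_xor parity w) (sym (type-ofType (type k xor σ p r) (2≤s r))) ⟩
        type m xor parity w               ∎

    Arc-DistLe3 : (∀ β p q → ShortWalk β p q) → ∀ u v → DistLe Arc 3 u v
    Arc-DistLe3 shortWalk (p , k) (q , l) =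
      let (n , n≤2 , w , parity-w) = shortWalk (type k xor type l) p q
      in suc n , s≤s n≤2 , lift w k l (trans (sym (xor-cancelˡ (type k) (type l)))
                                              (cong (type k xor_) (sym parity-w)))

    switching-minOrientedDiam3 : (∀ β p q → ShortWalk β p q) →
      ∀ {p q} → E H p q → NoCommonNeighbour H p q → NoCommonNeighbour H q p →
      MinOrientedDiam (VMult H s) 3
    switching-minOrientedDiam3 shortWalk {p} {q} pq noPQ noQP =
        (Arc , Arc-isOrientation , DistLe-all⇒Strong reach ,
         reach , farPair G Arc-isOrientation {u} {v} uv noUV noVU)
      , λ _ orientation _ _ → orientedDiam≥3 G orientation {u} {v} uv noUV noVU
      where
      G : Graph
      G = VMult H s

      reach : ∀ u v → DistLe Arc 3 u v
      reach = Arc-DistLe3 shortWalk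

      u v : V G
      u = p , ofType false (2≤s p)
      v = q , ofType false (2≤s q)

      uv : E G u v
      uv = loopless pq , pq

      noUV : NoCommonNeighbour G u v
      noUV = VMult-noCommonNeighbour H s noPQ (proj₂ u) (proj₂ v)

      noVU : NoCommonNeighbour G v u
      noVU = VMult-noCommonNeighbour H s noQP (proj₂ v) (proj₂ u)

□-sym : ∀ {μ} {p q : V (P₂ □ K μ)} → E (P₂ □ K μ) p q → E (P₂ □ K μ) q p
□-sym {p = _ , _} {_ , _} (inj₁ (a≡b , i≢j)) = inj₁ (sym a≡b , ≢-sym i≢j)
□-sym {p = _ , _} {_ , _} (inj₂ (a≢b , i≡j)) = inj₂ (≢-sym a≢b , sym i≡j)

□-loopless : ∀ {μ} {p q : V (P₂ □ K μ)} → E (P₂ □ K μ) p q → p ≢ q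
□-loopless {p = _ , _} {_ , _} (inj₁ (_ , i≢j)) refl = i≢j refl
□-loopless {p = _ , _} {_ , _} (inj₂ (a≢b , _)) refl = a≢b refl

-- Layer 1 carries the reverse of the tournament on layer 0; this is what makes every 4-cycle odd.
sign : ∀ {μ} → V (P₂ □ K μ) → V (P₂ □ K μ) → Bool
sign (zero     , i) (zero     , j) = toℕ i <ᵇ toℕ j
sign (suc zero , i) (suc zero , j) = toℕ j <ᵇ toℕ i
sign (zero     , _) (suc zero , _) = true
sign (suc zero , _) (zero     , _) = false

sign-antisym : ∀ {μ} {p q : V (P₂ □ K μ)} → E (P₂ □ K μ) p q → sign q p ≡ not (sign p q)
sign-antisym {p = zero     , i} {zero     , j} (inj₁ (_ , i≢j)) = <ᵇ-flip (i≢j ∘ toℕ-injective)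
sign-antisym {p = suc zero , i} {suc zero , j} (inj₁ (_ , i≢j)) =
  <ᵇ-flip (≢-sym i≢j ∘ toℕ-injective)
sign-antisym {p = zero     , _} {zero     , _} (inj₂ (a≢b , _)) = contradiction refl a≢b
sign-antisym {p = suc zero , _} {suc zero , _} (inj₂ (a≢b , _)) = contradiction refl a≢b
sign-antisym {p = zero     , _} {suc zero , _} _ = refl
sign-antisym {p = suc zero , _} {zero     , _} _ = refl

otherTwo : ∀ {μ} → 3 ≤ μ → (i : Fin μ) → Σ (Fin μ) λ j → Σ (Fin μ) λ k → i ≢ j × j ≢ k × k ≢ i
otherTwo (s≤s (s≤s (s≤s _))) zero          = suc zero , suc (suc zero) , (λ ()) , (λ ()) , (λ ())
otherTwo (s≤s (s≤s (s≤s _))) (suc zero)    = zero , suc (suc zero) , (λ ()) , (λ ()) , (λ ())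
otherTwo (s≤s (s≤s (s≤s _))) (suc (suc _)) = zero , suc zero , (λ ()) , (λ ()) , (λ ())

module _ {μ : ℕ} where

  open Switching (P₂ □ K μ) □-sym sign sign-antisym

  along-layer : ∀ {a i j} → i ≢ j → E (P₂ □ K μ) (a , i) (a , j)
  along-layer i≢j = inj₁ (refl , i≢j)

  rung : ∀ {a b i} → a ≢ b → E (P₂ □ K μ) (a , i) (b , i)
  rung a≢b = inj₂ (a≢b , refl)

  rung-noCommonNeighbour : ∀ {a b i} → a ≢ b → NoCommonNeighbour (P₂ □ K μ) (a , i) (b , i)
  rung-noCommonNeighbour a≢b _ (inj₁ (refl , _))   (inj₁ (refl , _))   = a≢b refl
  rung-noCommonNeighbour _   _ (inj₁ (_ , i≢j))    (inj₂ (_ , refl))   = i≢j refl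
  rung-noCommonNeighbour _   _ (inj₂ (_ , refl))   (inj₁ (_ , j≢i))    = j≢i refl
  rung-noCommonNeighbour a≢b _ (inj₂ (a≢c , refl)) (inj₂ (c≢b , _))    = pigeonhole-Fin2 a≢b a≢c c≢b

  square-opposite-parity : ∀ {a b i j} (a≢b : a ≢ b) (i≢j : i ≢ j) →
    parity (along-layer {a} i≢j ∷ (rung {i = j} a≢b ∷ [])) ≡
    not (parity (rung {i = i} a≢b ∷ (along-layer {b} i≢j ∷ [])))
  square-opposite-parity {zero}     {zero}     a≢b _ = contradiction refl a≢b
  square-opposite-parity {suc zero} {suc zero} a≢b _ = contradiction refl a≢b
  square-opposite-parity {zero}     {suc zero} {i} {j} _ i≢j
    with toℕ i <ᵇ toℕ j | <ᵇ-flip {toℕ i} {toℕ j} (i≢j ∘ toℕ-injective)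
  ... | false | flip rewrite flip = refl
  ... | true  | flip rewrite flip = refl
  square-opposite-parity {suc zero} {zero}     {i} {j} _ i≢j
    with toℕ i <ᵇ toℕ j | <ᵇ-flip {toℕ i} {toℕ j} (i≢j ∘ toℕ-injective)
  ... | false | flip rewrite flip = refl
  ... | true  | flip rewrite flip = refl

  □-shortWalk : 3 ≤ μ → ∀ β p q → ShortWalk β p q
  □-shortWalk 3≤μ β (a , i) (b , j) with a ≟ᶠ b | i ≟ᶠ j
  ... | yes refl | yes refl =
    let (k , l , i≢k , k≢l , l≢i) = otherTwo 3≤μ i
    in triangle-shortWalk (along-layer i≢k) (along-layer k≢l) (along-layer l≢i) β
  ... | yes refl | no i≢j  = edge-shortWalk (along-layer i≢j) β
  ... | no a≢b   | yes refl = edge-shortWalk (rung a≢b) β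
  ... | no a≢b   | no i≢j  =
    shortWalk-either (along-layer i≢j ∷ (rung a≢b ∷ [])) (rung a≢b ∷ (along-layer i≢j ∷ []))
                     (s≤s z≤n) (s≤s z≤n) (square-opposite-parity a≢b i≢j) β

  □-DistLe2 : ∀ p q → DistLe (E (P₂ □ K μ)) 2 p q
  □-DistLe2 (a , i) (b , j) with a ≟ᶠ b | i ≟ᶠ j
  ... | yes refl | yes refl = 0 , z≤n , []
  ... | yes refl | no i≢j  = 1 , s≤s z≤n , (along-layer i≢j ∷ [])
  ... | no a≢b   | yes refl = 1 , s≤s z≤n , (rung a≢b ∷ [])
  ... | no a≢b   | no i≢j  = 2 , s≤s (s≤s z≤n) , (along-layer i≢j ∷ (rung a≢b ∷ []))

  □-isDiam2 : 2 ≤ μ → IsDiam (E (P₂ □ K μ)) 2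
  □-isDiam2 (s≤s (s≤s _)) = □-DistLe2 , (zero , zero) , (suc zero , suc zero) , far
    where
    far : DistGe (E (P₂ □ K μ)) 2 (zero , zero) (suc zero , suc zero)
    far 0 _ ()
    far 1 _ (inj₁ (() , _) ∷ [])
    far 1 _ (inj₂ (_ , ()) ∷ [])
    far (suc (suc _)) (s≤s (s≤s ())) _

proposition4p4 : ∀ (μ : ℕ) → 3 ≤ μ →
    ∀ (s : Fin 2 × Fin μ → ℕ) → (∀ i → 2 ≤ s i) →
    InC₁ (P₂ □ K μ) s
proposition4p4 μ 3≤μ@(s≤s _) s 2≤s =
  DistLe-all⇒Strong □-DistLe2 , 2≤s , 2 , □-isDiam2 (≤-trans (n≤1+n 2) 3≤μ) ,
  switching-minOrientedDiam3 s 2≤s □-loopless (□-shortWalk 3≤μ)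
    {zero , zero} {suc zero , zero} (rung (λ ()))
    (rung-noCommonNeighbour (λ ())) (rung-noCommonNeighbour (λ ()))
  where open Switching (P₂ □ K μ) □-sym sign sign-antisym
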